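{- Let $k\ge 2$, let $G$ be any graph, and let $H$ be a graph admitting a closed neighborhood balanced $k$-coloring $c$ with $|c^{ -1}(1)|=|c^{ -1}(2)|=\cdots=|c^{ -1}(k)|$. Then the lexicographic product $G[H]$ admits a closed neighborhood balanced $k$-coloring.
   Context: All graphs are finite and simple with nonempty vertex sets. $N[v]$ is the closed neighborhood of $v$. A closed neighborhood balanced $k$-coloring of a graph is a map $c$ from its vertex set to $\{1,\dots,k\}$ such that for every vertex $v$ the numbers $|N[v]\cap c^{ -1}(i)|$, $i=1,\dots,k$, are all equal. The lexicographic product $G[H]$ has vertex set $V(G)\times V(H)$, with $(g,h)$ and $(g',h')$ adjacent iff $gg'\in E(G)$, or $g=g'$ and $hh'\in E(H)$. -}

module Defs where

open import Data.Nat using (ℕ; zero; suc; _+_; _*_)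
open import Data.Bool using (Bool; true; false; _∨_; _∧_; if_then_else_)
open import Data.Fin using (Fin; zero; suc; _≟_; remQuot)
open import Data.Product using (_×_; _,_; proj₁; proj₂)
open import Relation.Nullary.Decidable using (⌊_⌋)
open import Relation.Binary.PropositionalEquality using (_≡_)

-- A finite simple graph on vertex set Fin n (n ≥ 1 imposed separately):
-- a Bool-valued adjacency relation that is irreflexive and symmetric.
record Graph : Set where
  field
    size  : ℕ
    adj   : Fin size → Fin size → Bool
    irrefl : ∀ v → adj v v ≡ false
    sym   : ∀ u v → adj u v ≡ adj v u

open Graph public

countF : (n : ℕ) → (Fin n → Bool) → ℕ
countF zero    p = 0
countF (suc n) p = (if p zero then 1 else 0) + countF n (λ i → p (suc i))

inClosedNbhd : {n : ℕ} → (Fin n → Fin n → Bool) → Fin n → Fin n → Bool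
inClosedNbhd a v u = ⌊ u ≟ v ⌋ ∨ a v u

nbhdColorCount : {n k : ℕ} → (Fin n → Fin n → Bool) → (Fin n → Fin k) → Fin n → Fin k → ℕ
nbhdColorCount {n} a c v i = countF n (λ u → inClosedNbhd a v u ∧ ⌊ c u ≟ i ⌋)

-- closed neighborhood balanced k-coloring (colors 1..k represented as Fin k)
-- of the graph with vertex set Fin n and adjacency a
IsCNBColoringAdj : {n : ℕ} (a : Fin n → Fin n → Bool) (k : ℕ) → (Fin n → Fin k) → Set
IsCNBColoringAdj a k c = ∀ v (i j : Fin k) → nbhdColorCount a c v i ≡ nbhdColorCount a c v j

IsCNBColoring : (G : Graph) (k : ℕ) → (Fin (size G) → Fin k) → Set
IsCNBColoring G k c = IsCNBColoringAdj (adj G) k c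

colorClassSize : (G : Graph) {k : ℕ} → (Fin (size G) → Fin k) → Fin k → ℕ
colorClassSize G c i = countF (size G) (λ u → ⌊ c u ≟ i ⌋)

-- adjacency of the lexicographic product G[H]; vertex (g,h) is encoded as an
-- element of Fin (|G| * |H|) via remQuot (a bijection Fin (m*n) ≃ Fin m × Fin n)
lexAdj : (G H : Graph) → Fin (size G * size H) → Fin (size G * size H) → Bool
lexAdj G H x y with remQuot (size H) x | remQuot (size H) y
... | (g , h) | (g' , h') = adj G g g' ∨ (⌊ g ≟ g' ⌋ ∧ adj H h h')

-- Colour (g, h) by c h.  The closed neighbourhood of (g, h) in G[H] meets the
-- fibre {g} × H in {g} × N_H[h], which c balances; it contains the whole fibre
-- {g'} × H for each neighbour g' of g, balanced because the colour classes of c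
-- have equal size; and it misses every other fibre.
module Submission where

open import Defs hiding (sym)
open import Data.Nat using (ℕ; zero; suc; _≤_; _+_; _*_)
open import Data.Nat.Properties using (+-assoc)
open import Data.Bool using (Bool; true; false; _∨_; _∧_; if_then_else_)
open import Data.Bool.Properties using (∨-identityʳ)
open import Data.Fin using (Fin; zero; suc; _≟_; remQuot; combine; _↑ˡ_; _↑ʳ_)
open import Data.Fin.Properties
  using (remQuot-combine; combine-remQuot; combine-injectiveˡ; combine-injectiveʳ)
open import Data.Product using (Σ; _,_; proj₂; uncurry)
open import Function using (_∘_)
open import Relation.Nullary using (Dec; yes; no; ¬_)
open import Relation.Nullary.Decidable using (⌊_⌋; isYes≗does; dec-true; dec-false)
open import Relation.Binary.PropositionalEquality
  using (_≡_; _≢_; _≗_; refl; sym; trans; cong; cong₂; subst; module ≡-Reasoning)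

countF-cong : ∀ n {p q : Fin n → Bool} → p ≗ q → countF n p ≡ countF n q
countF-cong zero    p≗q = refl
countF-cong (suc n) p≗q =
  cong₂ _+_ (cong (λ b → if b then 1 else 0) (p≗q zero)) (countF-cong n (p≗q ∘ suc))

countF-false : ∀ n → countF n (λ _ → false) ≡ 0
countF-false zero    = refl
countF-false (suc n) = countF-false n

countF-∧ˡ : ∀ n b (p : Fin n → Bool) →
  countF n (λ x → b ∧ p x) ≡ (if b then countF n p else 0)
countF-∧ˡ n true  p = refl
countF-∧ˡ n false p = countF-false n

countF-+ : ∀ a b (p : Fin (a + b) → Bool) →
  countF (a + b) p ≡ countF a (p ∘ (_↑ˡ b)) + countF b (p ∘ (a ↑ʳ_))
countF-+ zero    b p = refl
countF-+ (suc a) b p = begin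
  head + countF (a + b) (p ∘ suc)
    ≡⟨ cong (head +_) (countF-+ a b (p ∘ suc)) ⟩
  head + (countF a (p ∘ suc ∘ (_↑ˡ b)) + countF b (p ∘ suc ∘ (a ↑ʳ_)))
    ≡⟨ sym (+-assoc head _ _) ⟩
  head + countF a (p ∘ suc ∘ (_↑ˡ b)) + countF b (p ∘ suc ∘ (a ↑ʳ_)) ∎
  where
  open ≡-Reasoning
  head : ℕ
  head = if p zero then 1 else 0

countF-combine-cong : ∀ m n (p q : Fin (m * n) → Bool) →
  (∀ (g : Fin m) → countF n (p ∘ combine g) ≡ countF n (q ∘ combine g)) →
  countF (m * n) p ≡ countF (m * n) q
countF-combine-cong zero    n p q fibres = refl
countF-combine-cong (suc m) n p q fibres = begin
  countF (n + m * n) p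
    ≡⟨ countF-+ n (m * n) p ⟩
  countF n (p ∘ (_↑ˡ m * n)) + countF (m * n) (p ∘ (n ↑ʳ_))
    ≡⟨ cong₂ _+_ (fibres zero) (countF-combine-cong m n _ _ (fibres ∘ suc)) ⟩
  countF n (q ∘ (_↑ˡ m * n)) + countF (m * n) (q ∘ (n ↑ʳ_))
    ≡⟨ sym (countF-+ n (m * n) q) ⟩
  countF (n + m * n) q ∎
  where open ≡-Reasoning

⌊⌋-true : ∀ {ℓ} {A : Set ℓ} (a? : Dec A) → A → ⌊ a? ⌋ ≡ true
⌊⌋-true a? a = trans (isYes≗does a?) (dec-true a? a)

⌊⌋-false : ∀ {ℓ} {A : Set ℓ} (a? : Dec A) → ¬ A → ⌊ a? ⌋ ≡ false
⌊⌋-false a? ¬a = trans (isYes≗does a?) (dec-false a? ¬a)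

≟-combineʳ : ∀ {m n} (g : Fin m) (h h' : Fin n) →
  ⌊ combine g h ≟ combine g h' ⌋ ≡ ⌊ h ≟ h' ⌋
≟-combineʳ g h h' with h ≟ h'
... | yes refl = ⌊⌋-true (combine g h ≟ combine g h) refl
... | no h≢h'  = ⌊⌋-false (combine g h ≟ combine g h') (h≢h' ∘ combine-injectiveʳ g h g h')

≟-combineˡ : ∀ {m n} {g g' : Fin m} → g ≢ g' → (h h' : Fin n) →
  ⌊ combine g h ≟ combine g' h' ⌋ ≡ false
≟-combineˡ g≢g' h h' = ⌊⌋-false (_ ≟ _) (g≢g' ∘ combine-injectiveˡ _ h _ h')

module _ (G H : Graph) where

  lexAdj-combine : ∀ g h g' h' →
    lexAdj G H (combine g h) (combine g' h') ≡ (adj G g g' ∨ (⌊ g ≟ g' ⌋ ∧ adj H h h'))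
  lexAdj-combine g h g' h' =
    cong₂ (λ (g₁ , h₁) (g₂ , h₂) → adj G g₁ g₂ ∨ (⌊ g₁ ≟ g₂ ⌋ ∧ adj H h₁ h₂))
      (remQuot-combine {size G} {size H} g h) (remQuot-combine {size G} {size H} g' h')

  inClosedNbhd-lex-fibre : ∀ g h h' →
    inClosedNbhd (lexAdj G H) (combine g h) (combine g h') ≡ inClosedNbhd (adj H) h h'
  inClosedNbhd-lex-fibre g h h'
    rewrite lexAdj-combine g h g h' | irrefl G g | ⌊⌋-true (g ≟ g) refl
          | ≟-combineʳ g h' h = refl

  inClosedNbhd-lex-otherFibre : ∀ {g g'} → g ≢ g' → ∀ h h' →
    inClosedNbhd (lexAdj G H) (combine g h) (combine g' h') ≡ adj G g g'
  inClosedNbhd-lex-otherFibre {g} {g'} g≢g' h h'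
    rewrite lexAdj-combine g h g' h' | ⌊⌋-false (g ≟ g') g≢g'
          | ≟-combineˡ (g≢g' ∘ sym) h' h = ∨-identityʳ (adj G g g')

  module _ {k : ℕ} (c : Fin (size H) → Fin k) where

    lexColoring : Fin (size G * size H) → Fin k
    lexColoring = c ∘ proj₂ ∘ remQuot {size G} (size H)

    lexColoring-combine : ∀ g h → lexColoring (combine g h) ≡ c h
    lexColoring-combine g h = cong (c ∘ proj₂) (remQuot-combine {size G} {size H} g h)

    fibreColorCount : Fin (size G) → Fin (size H) → Fin (size G) → Fin k → ℕ
    fibreColorCount g h g' i = countF (size H) (λ h' →
      inClosedNbhd (lexAdj G H) (combine g h) (combine g' h') ∧ ⌊ lexColoring (combine g' h') ≟ i ⌋)

    fibreColorCount-self : ∀ g h i → fibreColorCount g h g i ≡ nbhdColorCount (adj H) c h i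
    fibreColorCount-self g h i = countF-cong (size H) λ h' →
      cong₂ (λ b x → b ∧ ⌊ x ≟ i ⌋) (inClosedNbhd-lex-fibre g h h') (lexColoring-combine g h')

    fibreColorCount-other : ∀ {g g'} → g ≢ g' → ∀ h i →
      fibreColorCount g h g' i ≡ (if adj G g g' then colorClassSize H c i else 0)
    fibreColorCount-other {g} {g'} g≢g' h i = trans
      (countF-cong (size H) λ h' →
        cong₂ (λ b x → b ∧ ⌊ x ≟ i ⌋) (inClosedNbhd-lex-otherFibre g≢g' h h') (lexColoring-combine g' h'))
      (countF-∧ˡ (size H) (adj G g g') (λ h' → ⌊ c h' ≟ i ⌋))

    fibreColorCount-balanced : IsCNBColoring H k c →
      (∀ i j → colorClassSize H c i ≡ colorClassSize H c j) →
      ∀ g h g' i j → fibreColorCount g h g' i ≡ fibreColorCount g h g' j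
    fibreColorCount-balanced balanced equalClasses g h g' i j with g ≟ g'
    ... | yes refl = begin
      fibreColorCount g h g i         ≡⟨ fibreColorCount-self g h i ⟩
      nbhdColorCount (adj H) c h i    ≡⟨ balanced h i j ⟩
      nbhdColorCount (adj H) c h j    ≡⟨ sym (fibreColorCount-self g h j) ⟩
      fibreColorCount g h g j         ∎
      where open ≡-Reasoning
    ... | no g≢g' = begin
      fibreColorCount g h g' i                                  ≡⟨ fibreColorCount-other g≢g' h i ⟩
      (if adj G g g' then colorClassSize H c i else 0)
        ≡⟨ cong (λ s → if adj G g g' then s else 0) (equalClasses i j) ⟩
      (if adj G g g' then colorClassSize H c j else 0)          ≡⟨ sym (fibreColorCount-other g≢g' h j) ⟩
      fibreColorCount g h g' j                                  ∎
      where open ≡-Reasoning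

    lexColoring-isCNBColoring : IsCNBColoring H k c →
      (∀ i j → colorClassSize H c i ≡ colorClassSize H c j) →
      IsCNBColoringAdj (lexAdj G H) k lexColoring
    lexColoring-isCNBColoring balanced equalClasses x i j =
      subst (λ v → count v i ≡ count v j) (combine-remQuot {size G} (size H) x)
        (countAt (remQuot (size H) x))
      where
      count : Fin (size G * size H) → Fin k → ℕ
      count = nbhdColorCount (lexAdj G H) lexColoring
      countAt : ∀ gh → count (uncurry combine gh) i ≡ count (uncurry combine gh) j
      countAt (g , h) = countF-combine-cong (size G) (size H) _ _
        (λ g' → fibreColorCount-balanced balanced equalClasses g h g' i j)

theorem2p20 : (k : ℕ) → 2 ≤ k → (G H : Graph) → 1 ≤ size G → 1 ≤ size H →
    (c : Fin (size H) → Fin k) → IsCNBColoring H k c →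
    (∀ i j → colorClassSize H c i ≡ colorClassSize H c j) →
    Σ (Fin (size G * size H) → Fin k) (λ c' → IsCNBColoringAdj (lexAdj G H) k c')
theorem2p20 k _ G H _ _ c balanced equalClasses =
  lexColoring G H c , lexColoring-isCNBColoring G H c balanced equalClasses
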